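{- Let $\sigma$ be a finite signature and $\mathcal{L}[\mathcal{Q}]$ a $k$-quantifier logic with $\mathcal{Q}_\sigma$ finite. For all $q\in\mathbb{N}$ and all $k$-pointed $\sigma$-structures $(\mathfrak{A},\alpha)$ and $(\mathfrak{B},\beta)$: $\mathfrak{B},\beta\models\chi^q_{\mathfrak{A},\alpha}$ if and only if $(\mathfrak{B},\beta)\sim^q_{\mathcal{L}[\mathcal{Q}]}(\mathfrak{A},\alpha)$.
   Context: All signatures are purely relational. Fix $k\ge1$ and variables $x_1,\dots,x_k$; a $k$-pointed $\sigma$-structure is a pair $(\mathfrak{A},\alpha)$ with $\alpha\in A^k$. A $k$-quantifier $Q$ consists of a signature $\sigma_Q$ and, for every structure $\mathfrak{A}$ over a signature containing $\sigma_Q$ and every $\alpha\in A^k$, a witness set $Q(\mathfrak{A},\alpha)\subseteq\mathcal{P}(A^k)$, such that for every isomorphism $\iota:\mathfrak{A}\restriction\sigma_Q\cong\mathfrak{B}\restriction\sigma_Q$ and $\alpha\in A^k$: $Q(\mathfrak{B}\restriction\sigma_Q,\iota\circ\alpha)=Q(\mathfrak{B},\iota\circ\alpha)=\{\{\iota\circ\gamma:\gamma\in s\}:s\in Q(\mathfrak{A}\restriction\sigma_Q,\alpha)\}$. For a class $\mathcal{Q}$ of $k$-quantifiers, $\mathcal{Q}_\sigma=\{Q\in\mathcal{Q}:\sigma_Q\subseteq\sigma\}$. The $k$-quantifier logic $\mathcal{L}[\mathcal{Q}]$: formulas over $\sigma$ are built from $\top$ and atoms $R(y_1,\dots,y_l)$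 ($R\in\sigma$, $y_j\in\{x_1,\dots,x_k\}$) by $\neg$, $\wedge$ (and derived $\vee$), and $Q\varphi$ for $Q\in\mathcal{Q}_\sigma$; semantics is the usual one for $\top$, atoms, boolean connectives, and $\mathfrak{A},\alpha\models Q\varphi$ iff some $s\in Q(\mathfrak{A},\alpha)$ has $\mathfrak{A},\gamma\models\varphi$ for all $\gamma\in s$. Characteristic formulas. $\chi^0_{\mathfrak{A},\alpha}$ is the conjunction of all atoms and negated atoms (over $\sigma$ and $x_1,\dots,x_k$) true at $(\mathfrak{A},\alpha)$. Let $\Delta_q=\{\chi^q_{\mathfrak{B},\beta}:(\mathfrak{B},\beta)\text{ a }k\text{ -pointed }\sigma\text{ -structure}\}$. Then $\chi^{q+1}_{\mathfrak{A},\alpha}=\chi^0_{\mathfrak{A},\alpha}\wedge\bigwedge_{Q\in\mathcal{Q}_\sigma}\Big(\bigwedge_{s\in Q(\mathfrak{A},\alpha)}Q\bigvee_{\gamma\in s}\chi^q_{\mathfrak{A},\gamma}\ \wedge\ \bigwedge\{\neg Q\bigvee\Phi:\Phi\subseteq\Delta_q,\ \mathfrak{A},\alpha\models\neg Q\bigvee\Phi\}\Big)$, where all conjunctions and disjunctions are taken over the corresponding sets of formulas (these sets are finite, so the $\chi^q$ are formulas of $\mathcal{L}[\mathcal{Q}](\sigma)$). $q$-round bisimulation game: players I and II, positions $(\mathfrak{A},\alpha;\mathfrak{B},\beta)$. II loses in any position where the two sides are distinguished by a quantifier-free formula. A round: I picks a side, say $(\mathfrak{A},\alpha)$ (symmetrically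 for the other), $Q\in\mathcal{Q}_\sigma$ and $s\in Q(\mathfrak{A},\alpha)$; II answers $t\in Q(\mathfrak{B},\beta)$; I picks $\delta\in t$; II answers $\gamma\in s$; new position $(\mathfrak{A},\gamma;\mathfrak{B},\delta)$. A player unable to move loses; II wins if I loses or neither player loses during $q$ rounds. $\sim^q_{\mathcal{L}[\mathcal{Q}]}$ holds between two $k$-pointed structures if II has a winning strategy in this game from the corresponding position. -}

module Defs where

open import Level using (Level; 0ℓ; Lift; lift) renaming (suc to lsuc)
open import Data.Nat using (ℕ; zero; suc)
open import Data.Fin using (Fin)
open import Data.Bool using (Bool; true; false; if_then_else_)
open import Data.Unit using (⊤)
open import Data.Product using (Σ; Σ-syntax; ∃; _×_; _,_)
open import Relation.Binary.PropositionalEquality using (_≡_)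
open import Relation.Nullary using (¬_)
open import Relation.Unary using (Pred)
open import Function using (_∘_)
open import Function.Bundles using (_↔_; Inverse; _⇔_)

record Signature : Set where
  field
    size  : ℕ
    arity : Fin size → ℕ
open Signature public

record Structure (σ : Signature) : Set₁ where
  field
    Carrier : Set
    rel     : (R : Fin (size σ)) → (Fin (arity σ R) → Carrier) → Bool
open Structure public

Tuple : (k : ℕ) {σ : Signature} → Structure σ → Set
Tuple k 𝔄 = Fin k → Carrier 𝔄

Pointed : ℕ → Signature → Set₁
Pointed k σ = Σ[ 𝔄 ∈ Structure σ ] Tuple k 𝔄

Subset : (k : ℕ) {σ : Signature} → Structure σ → Set₁
Subset k 𝔄 = Pred (Tuple k 𝔄) 0ℓ

SubSig : Signature → Set
SubSig σ = Fin (size σ) → Bool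

record ReductIso {σ : Signature} (τ : SubSig σ) (𝔄 𝔅 : Structure σ) : Set where
  field
    bij      : Carrier 𝔄 ↔ Carrier 𝔅
    preserve : ∀ R → τ R ≡ true → (a : Fin (arity σ R) → Carrier 𝔄) →
               rel 𝔄 R a ≡ rel 𝔅 R (Inverse.to bij ∘ a)
  ι : Carrier 𝔄 → Carrier 𝔅
  ι = Inverse.to bij

-- A k-quantifier Q with σ_Q ⊆ σ, given by its witness sets Q(𝔄,α) on
-- σ-structures, subject to isomorphism invariance w.r.t. σ_Q-reducts.
record Quantifier (k : ℕ) (σ : Signature) : Set₂ where
  field
    sigQ    : SubSig σ
    witness : (𝔄 : Structure σ) → Tuple k 𝔄 → Pred (Subset k 𝔄) 0ℓ
    invariant :
      (𝔄 𝔅 : Structure σ) (iso : ReductIso sigQ 𝔄 𝔅) (α : Tuple k 𝔄)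
      (β : Tuple k 𝔅) → (∀ i → ReductIso.ι iso (α i) ≡ β i) →
      (t : Subset k 𝔅) →
      witness 𝔅 β t ⇔
        (Σ[ s ∈ Subset k 𝔄 ] witness 𝔄 α s ×
           (∀ δ → t δ ⇔ (Σ[ γ ∈ Tuple k 𝔄 ] s γ ×
                            (∀ i → ReductIso.ι iso (γ i) ≡ δ i))))
open Quantifier public

module Logic (k : ℕ) (σ : Signature) (m : ℕ) (𝒬 : Fin m → Quantifier k σ) where

  data QF : Set where
    ⊤'   : QF
    atom : (R : Fin (size σ)) → (Fin (arity σ R) → Fin k) → QF
    ¬'_  : QF → QF
    _∧'_ : QF → QF → QF

  satQF : (𝔄 : Structure σ) → Tuple k 𝔄 → QF → Set
  satQF 𝔄 α ⊤'         = ⊤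
  satQF 𝔄 α (atom R y) = rel 𝔄 R (α ∘ y) ≡ true
  satQF 𝔄 α (¬' φ)     = ¬ satQF 𝔄 α φ
  satQF 𝔄 α (φ ∧' ψ)   = satQF 𝔄 α φ × satQF 𝔄 α ψ

  -- Formulas of L[𝒬](σ), with conjunctions and disjunctions over
  -- (possibly infinite) index families, used to write the
  -- characteristic formulas literally.
  data Form : Set₂ where
    ⊤'   : Form
    atom : (R : Fin (size σ)) → (Fin (arity σ R) → Fin k) → Form
    ¬'_  : Form → Form
    _∧'_ : Form → Form → Form
    ⋀    : {I : Set₁} → (I → Form) → Form
    ⋁    : {I : Set₁} → (I → Form) → Form
    Qf   : Fin m → Form → Form

  _⊨_[_] : (𝔄 : Structure σ) → Tuple k 𝔄 → Form → Set₁
  𝔄 ⊨ α [ ⊤' ]       = Lift _ ⊤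
  𝔄 ⊨ α [ atom R y ] = Lift _ (rel 𝔄 R (α ∘ y) ≡ true)
  𝔄 ⊨ α [ ¬' φ ]     = ¬ (𝔄 ⊨ α [ φ ])
  𝔄 ⊨ α [ φ ∧' ψ ]   = (𝔄 ⊨ α [ φ ]) × (𝔄 ⊨ α [ ψ ])
  𝔄 ⊨ α [ ⋀ f ]      = ∀ i → 𝔄 ⊨ α [ f i ]
  𝔄 ⊨ α [ ⋁ f ]      = ∃ λ i → 𝔄 ⊨ α [ f i ]
  𝔄 ⊨ α [ Qf j φ ]   =
    Σ[ s ∈ Subset k 𝔄 ] witness (𝒬 j) 𝔄 α s × (∀ γ → s γ → 𝔄 ⊨ γ [ φ ])

  Literal : Set
  Literal = Σ[ R ∈ Fin (size σ) ] (Fin (arity σ R) → Fin k)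

  χ0 : (𝔄 : Structure σ) → Tuple k 𝔄 → Form
  χ0 𝔄 α = ⋀ {I = Lift _ Literal} λ where
    (lift (R , y)) → if rel 𝔄 R (α ∘ y) then atom R y else ¬' atom R y

  -- A subset Φ ⊆ Δ_q, given as a family of k-pointed σ-structures
  -- (Φ = {χ^q_{𝔅,β} : (𝔅,β) in the family}).
  Family : Set₁
  Family = Σ[ I ∈ Set ] (I → Pointed k σ)

  χ : ℕ → (𝔄 : Structure σ) → Tuple k 𝔄 → Form
  χ zero    𝔄 α = χ0 𝔄 α
  χ (suc q) 𝔄 α =
    χ0 𝔄 α ∧' ⋀ {I = Lift _ (Fin m)} λ where
      (lift j) →
        ⋀ {I = Σ[ s ∈ Subset k 𝔄 ] witness (𝒬 j) 𝔄 α s}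
          (λ where (s , _) → Qf j (⋁ {I = Lift _ (Σ[ γ ∈ Tuple k 𝔄 ] s γ)}
                                     (λ where (lift (γ , _)) → χ q 𝔄 γ)))
        ∧' ⋀ {I = Σ[ Φ ∈ Family ] (𝔄 ⊨ α [ ¬' Qf j (⋁Φ Φ) ])}
             (λ where (Φ , _) → ¬' Qf j (⋁Φ Φ))
    where
      ⋁Φ : Family → Form
      ⋁Φ (I , f) = ⋁ {I = Lift _ I} λ where
        (lift i) → let (𝔅 , β) = f i in χ q 𝔅 β

  Distinguished : (𝔄 : Structure σ) → Tuple k 𝔄 →
                  (𝔅 : Structure σ) → Tuple k 𝔅 → Set
  Distinguished 𝔄 α 𝔅 β = Σ[ φ ∈ QF ] ¬ (satQF 𝔄 α φ ⇔ satQF 𝔅 β φ)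

  IIWins : ℕ → (𝔄 : Structure σ) → Tuple k 𝔄 →
           (𝔅 : Structure σ) → Tuple k 𝔅 → Set₁
  IIWins zero    𝔄 α 𝔅 β = Lift (lsuc 0ℓ) (¬ Distinguished 𝔄 α 𝔅 β)
  IIWins (suc q) 𝔄 α 𝔅 β =
    Lift (lsuc 0ℓ) (¬ Distinguished 𝔄 α 𝔅 β)
    -- I chooses the side (𝔄,α), Q and s ∈ Q(𝔄,α)
    × (∀ j (s : Subset k 𝔄) → witness (𝒬 j) 𝔄 α s →
         Σ[ t ∈ Subset k 𝔅 ] witness (𝒬 j) 𝔅 β t ×
           (∀ δ → t δ → Σ[ γ ∈ Tuple k 𝔄 ] s γ × IIWins q 𝔄 γ 𝔅 δ))
    -- I chooses the side (𝔅,β), Q and t ∈ Q(𝔅,β)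
    × (∀ j (t : Subset k 𝔅) → witness (𝒬 j) 𝔅 β t →
         Σ[ s ∈ Subset k 𝔄 ] witness (𝒬 j) 𝔄 α s ×
           (∀ γ → s γ → Σ[ δ ∈ Tuple k 𝔅 ] t δ × IIWins q 𝔄 γ 𝔅 δ))

  _,_∼[_]_,_ : (𝔄 : Structure σ) → Tuple k 𝔄 → ℕ →
               (𝔅 : Structure σ) → Tuple k 𝔅 → Set₁
  𝔄 , α ∼[ q ] 𝔅 , β = IIWins q 𝔄 α 𝔅 β

-- A strategy for II is read off the
-- conjuncts of χ^{q+1}: the positive conjuncts Q ⋁_{γ∈s} χ^q_{𝔄,γ} answer
-- moves of I in 𝔄, and the negative conjuncts answer moves in 𝔅, because
-- if 𝔄,α refuted Q ⋁_{γ∈s} χ^q_{𝔅,γ} for a move s of I in 𝔅, that negation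
-- would be a conjunct of χ^{q+1}_{𝔄,α} refuted by s itself at 𝔅,β.
-- Conversely, a winning strategy transports the positive conjuncts, and a
-- negative conjunct survives since ∼^q is an equivalence relation.
module Submission where

open import Defs
open import Level using (Level; Lift; lift; lower; 0ℓ) renaming (suc to lsuc)
open import Data.Nat using (ℕ; _≤_; zero; suc)
open import Data.Fin using (Fin)
open import Data.Bool using (Bool; true; false)
open import Data.Product using (Σ; Σ-syntax; _×_; _,_; proj₁; proj₂)
open import Data.Product.Function.NonDependent.Propositional using (_×-⇔_)
open import Relation.Nullary using (¬_; yes; no; contradiction)
open import Relation.Binary.PropositionalEquality using (_≡_; refl; sym; trans)
open import Function using (_∘_)
open import Function.Bundles using (_⇔_; mk⇔; Equivalence)
open import Function.Properties.Equivalence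
  using () renaming (refl to ⇔-refl; sym to ⇔-sym; trans to ⇔-trans)
open import Function.Related.TypeIsomorphisms using (¬-cong-⇔)
open import Axiom.ExcludedMiddle using (ExcludedMiddle)

≡-from-¬¬-≡true-⇔ : ∀ {a b : Bool} → ¬ ¬ ((a ≡ true) ⇔ (b ≡ true)) → a ≡ b
≡-from-¬¬-≡true-⇔ {false} {false} _ = refl
≡-from-¬¬-≡true-⇔ {false} {true}  h = contradiction (λ e → contradiction (Equivalence.from e refl) λ ()) h
≡-from-¬¬-≡true-⇔ {true}  {false} h = contradiction (λ e → contradiction (Equivalence.to e refl) λ ()) h
≡-from-¬¬-≡true-⇔ {true}  {true}  _ = refl

module _ (k : ℕ) (σ : Signature) (m : ℕ) (𝒬 : Fin m → Quantifier k σ) where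
  open Logic k σ m 𝒬
  open Equivalence using (to; from)

  Indistinguishable : (𝔄 : Structure σ) → Tuple k 𝔄 → (𝔅 : Structure σ) → Tuple k 𝔅 → Set
  Indistinguishable 𝔄 α 𝔅 β = ¬ Distinguished 𝔄 α 𝔅 β

  AgreeOnAtoms : (𝔄 : Structure σ) → Tuple k 𝔄 → (𝔅 : Structure σ) → Tuple k 𝔅 → Set
  AgreeOnAtoms 𝔄 α 𝔅 β = ∀ R y → rel 𝔄 R (α ∘ y) ≡ rel 𝔅 R (β ∘ y)

  module _ {𝔄 : Structure σ} {α : Tuple k 𝔄} {𝔅 : Structure σ} {β : Tuple k 𝔅} where

    agree⇒satQF-⇔ : AgreeOnAtoms 𝔄 α 𝔅 β → ∀ φ → satQF 𝔄 α φ ⇔ satQF 𝔅 β φ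
    agree⇒satQF-⇔ ag ⊤'         = ⇔-refl
    agree⇒satQF-⇔ ag (atom R y) rewrite ag R y = ⇔-refl
    agree⇒satQF-⇔ ag (¬' φ)     = ¬-cong-⇔ (agree⇒satQF-⇔ ag φ)
    agree⇒satQF-⇔ ag (φ ∧' ψ)   = agree⇒satQF-⇔ ag φ ×-⇔ agree⇒satQF-⇔ ag ψ

    agree⇒indistinguishable : AgreeOnAtoms 𝔄 α 𝔅 β → Indistinguishable 𝔄 α 𝔅 β
    agree⇒indistinguishable ag (φ , ≢) = ≢ (agree⇒satQF-⇔ ag φ)

    indistinguishable⇒agree : Indistinguishable 𝔄 α 𝔅 β → AgreeOnAtoms 𝔄 α 𝔅 β
    indistinguishable⇒agree nd R y = ≡-from-¬¬-≡true-⇔ (λ ≢ → nd (atom R y , ≢))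

  indistinguishable-refl : ∀ 𝔄 α → Indistinguishable 𝔄 α 𝔄 α
  indistinguishable-refl 𝔄 α (φ , ≢) = ≢ ⇔-refl

  indistinguishable-sym : ∀ {𝔄 α 𝔅 β} → Indistinguishable 𝔄 α 𝔅 β → Indistinguishable 𝔅 β 𝔄 α
  indistinguishable-sym nd (φ , ≢) = nd (φ , ≢ ∘ ⇔-sym)

  indistinguishable-trans : ∀ {𝔄 α 𝔅 β ℭ γ} →
    Indistinguishable 𝔄 α 𝔅 β → Indistinguishable 𝔅 β ℭ γ → Indistinguishable 𝔄 α ℭ γ
  indistinguishable-trans nd₁ nd₂ (φ , ≢) = nd₁ (φ , λ e₁ → nd₂ (φ , λ e₂ → ≢ (⇔-trans e₁ e₂)))

  ⊨χ0⇒agree : ∀ 𝔄 α 𝔅 β → 𝔅 ⊨ β [ χ0 𝔄 α ] → AgreeOnAtoms 𝔅 β 𝔄 α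
  ⊨χ0⇒agree 𝔄 α 𝔅 β h R y with rel 𝔄 R (α ∘ y) | h (lift (R , y))
  ... | true  | lift e = e
  ... | false | ¬e with rel 𝔅 R (β ∘ y)
  ...   | true  = contradiction (lift refl) ¬e
  ...   | false = refl

  agree⇒⊨χ0 : ∀ 𝔄 α 𝔅 β → AgreeOnAtoms 𝔅 β 𝔄 α → 𝔅 ⊨ β [ χ0 𝔄 α ]
  agree⇒⊨χ0 𝔄 α 𝔅 β ag (lift (R , y)) with rel 𝔄 R (α ∘ y) | ag R y
  ... | true  | e = lift e
  ... | false | e = λ (lift e′) → contradiction (trans (sym e) e′) λ ()

  ⊨χ0⇔indistinguishable : ∀ 𝔄 α 𝔅 β → (𝔅 ⊨ β [ χ0 𝔄 α ]) ⇔ Indistinguishable 𝔅 β 𝔄 α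
  ⊨χ0⇔indistinguishable 𝔄 α 𝔅 β = mk⇔
    (agree⇒indistinguishable ∘ ⊨χ0⇒agree 𝔄 α 𝔅 β)
    (agree⇒⊨χ0 𝔄 α 𝔅 β ∘ indistinguishable⇒agree)

  ∼-refl : ∀ q 𝔄 α → 𝔄 , α ∼[ q ] 𝔄 , α
  ∼-refl zero    𝔄 α = lift (indistinguishable-refl 𝔄 α)
  ∼-refl (suc q) 𝔄 α =
      lift (indistinguishable-refl 𝔄 α)
    , (λ j s ws → s , ws , λ δ sδ → δ , sδ , ∼-refl q 𝔄 δ)
    , (λ j s ws → s , ws , λ γ sγ → γ , sγ , ∼-refl q 𝔄 γ)

  ∼-sym : ∀ q {𝔄 α 𝔅 β} → 𝔄 , α ∼[ q ] 𝔅 , β → 𝔅 , β ∼[ q ] 𝔄 , α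
  ∼-sym zero    (lift nd) = lift (indistinguishable-sym nd)
  ∼-sym (suc q) (lift nd , forth , back) =
      lift (indistinguishable-sym nd)
    , (λ j t wt → let (s , ws , h) = back j t wt in
         s , ws , λ δ sδ → let (γ , tγ , w) = h δ sδ in γ , tγ , ∼-sym q w)
    , (λ j t wt → let (s , ws , h) = forth j t wt in
         s , ws , λ δ sδ → let (γ , tγ , w) = h δ sδ in γ , tγ , ∼-sym q w)

  ∼-trans : ∀ q {𝔄 α 𝔅 β ℭ γ} → 𝔄 , α ∼[ q ] 𝔅 , β → 𝔅 , β ∼[ q ] ℭ , γ → 𝔄 , α ∼[ q ] ℭ , γ
  ∼-trans zero    (lift nd₁) (lift nd₂) = lift (indistinguishable-trans nd₁ nd₂)
  ∼-trans (suc q) (lift nd₁ , forth₁ , back₁) (lift nd₂ , forth₂ , back₂) =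
      lift (indistinguishable-trans nd₁ nd₂)
    , (λ j s ws → let (t , wt , h₁) = forth₁ j s ws ; (u , wu , h₂) = forth₂ j t wt in
        u , wu , λ ε uε → let (δ , tδ , w₂) = h₂ ε uε ; (γ , sγ , w₁) = h₁ δ tδ in
          γ , sγ , ∼-trans q w₁ w₂)
    , (λ j u wu → let (t , wt , h₂) = back₂ j u wu ; (s , ws , h₁) = back₁ j t wt in
        s , ws , λ γ sγ → let (δ , tδ , w₁) = h₁ γ sγ ; (ε , uε , w₂) = h₂ δ tδ in
          ε , uε , ∼-trans q w₁ w₂)

  Characterises : ℕ → Set₁
  Characterises q = ∀ 𝔄 α 𝔅 β → (𝔅 ⊨ β [ χ q 𝔄 α ]) ⇔ (𝔅 , β ∼[ q ] 𝔄 , α)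

  -- The disjunctions occurring in χ (suc q), in a form definitionally equal to theirs.
  ⋁χ : ℕ → (𝔄 : Structure σ) → Subset k 𝔄 → Form
  ⋁χ q 𝔄 s = ⋁ {I = Lift (lsuc 0ℓ) (Σ (Tuple k 𝔄) s)} (λ i → χ q 𝔄 (proj₁ (lower i)))

  ⋁χ-family : ℕ → Family → Form
  ⋁χ-family q (I , F) =
    ⋁ {I = Lift (lsuc 0ℓ) I} (λ i → χ q (proj₁ (F (lower i))) (proj₂ (F (lower i))))

  ⊨χ-suc⇒∼ : ExcludedMiddle (lsuc 0ℓ) → ∀ {q} → Characterises q →
             ∀ 𝔄 α 𝔅 β → 𝔅 ⊨ β [ χ (suc q) 𝔄 α ] → 𝔅 , β ∼[ suc q ] 𝔄 , α
  ⊨χ-suc⇒∼ em {q} IH 𝔄 α 𝔅 β (h₀ , h) =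
    lift (to (⊨χ0⇔indistinguishable 𝔄 α 𝔅 β) h₀) , forth , back
    where
    forth : ∀ j s → witness (𝒬 j) 𝔅 β s →
            Σ[ t ∈ Subset k 𝔄 ] witness (𝒬 j) 𝔄 α t ×
              (∀ δ → t δ → Σ[ γ ∈ Tuple k 𝔅 ] s γ × 𝔅 , γ ∼[ q ] 𝔄 , δ)
    forth j s ws with em {𝔄 ⊨ α [ Qf j (⋁χ q 𝔅 s) ]}
    ... | yes (t , wt , ⊨⋁) = t , wt , λ δ tδ →
            let (lift (γ , sγ) , ⊨χ) = ⊨⋁ δ tδ in γ , sγ , ∼-sym q (to (IH 𝔅 γ 𝔄 δ) ⊨χ)
    ... | no ⊭Q = contradiction
            (s , ws , λ γ sγ → lift (γ , sγ) , from (IH 𝔅 γ 𝔅 γ) (∼-refl q 𝔅 γ))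
            (proj₂ (h (lift j)) ((Σ (Tuple k 𝔅) s , λ (γ , _) → 𝔅 , γ) , ⊭Q))

    back : ∀ j t → witness (𝒬 j) 𝔄 α t →
           Σ[ s ∈ Subset k 𝔅 ] witness (𝒬 j) 𝔅 β s ×
             (∀ γ → s γ → Σ[ δ ∈ Tuple k 𝔄 ] t δ × 𝔅 , γ ∼[ q ] 𝔄 , δ)
    back j t wt = let (s , ws , ⊨⋁) = proj₁ (h (lift j)) (t , wt) in
      s , ws , λ γ sγ → let (lift (δ , tδ) , ⊨χ) = ⊨⋁ γ sγ in δ , tδ , to (IH 𝔄 δ 𝔅 γ) ⊨χ

  ∼⇒⊨χ-suc : ∀ {q} → Characterises q →
             ∀ 𝔄 α 𝔅 β → 𝔅 , β ∼[ suc q ] 𝔄 , α → 𝔅 ⊨ β [ χ (suc q) 𝔄 α ]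
  ∼⇒⊨χ-suc {q} IH 𝔄 α 𝔅 β (lift nd , forth , back) =
    from (⊨χ0⇔indistinguishable 𝔄 α 𝔅 β) nd , λ (lift j) → positive j , negative j
    where
    positive : ∀ j → (sw : Σ[ s ∈ Subset k 𝔄 ] witness (𝒬 j) 𝔄 α s) →
               𝔅 ⊨ β [ Qf j (⋁χ q 𝔄 (proj₁ sw)) ]
    positive j (s , ws) = let (t , wt , h) = back j s ws in
      t , wt , λ δ tδ → let (γ , sγ , w) = h δ tδ in lift (γ , sγ) , from (IH 𝔄 γ 𝔅 δ) w

    negative : ∀ j → (Φ⊭ : Σ[ Φ ∈ Family ] (𝔄 ⊨ α [ ¬' Qf j (⋁χ-family q Φ) ])) →
               𝔅 ⊨ β [ ¬' Qf j (⋁χ-family q (proj₁ Φ⊭)) ]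
    negative j ((I , F) , ⊭Q) (t , wt , ⊨⋁) = let (s , ws , h) = forth j t wt in
      ⊭Q (s , ws , λ γ sγ →
        let (δ , tδ , w) = h γ sγ ; (lift i , ⊨χ) = ⊨⋁ δ tδ ; (ℭ , ε) = F i in
        lift i , from (IH ℭ ε 𝔄 γ) (∼-trans q (∼-sym q w) (to (IH ℭ ε 𝔅 δ) ⊨χ)))

  χ-characterises : ExcludedMiddle (lsuc 0ℓ) → ∀ q → Characterises q
  χ-characterises em zero    𝔄 α 𝔅 β = mk⇔
    (lift ∘ to (⊨χ0⇔indistinguishable 𝔄 α 𝔅 β))
    (from (⊨χ0⇔indistinguishable 𝔄 α 𝔅 β) ∘ lower)
  χ-characterises em (suc q) 𝔄 α 𝔅 β = mk⇔
    (⊨χ-suc⇒∼ em (χ-characterises em q) 𝔄 α 𝔅 β)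
    (∼⇒⊨χ-suc (χ-characterises em q) 𝔄 α 𝔅 β)

proposition4p4 :
    ((ℓ : Level) → ExcludedMiddle ℓ) →
    (k : ℕ) → 1 ≤ k →
    (σ : Signature) →
    (m : ℕ) (𝒬 : Fin m → Quantifier k σ) →
    (q : ℕ) (𝔄 : Structure σ) (α : Tuple k 𝔄) (𝔅 : Structure σ) (β : Tuple k 𝔅) →
    (Logic._⊨_[_] k σ m 𝒬 𝔅 β (Logic.χ k σ m 𝒬 q 𝔄 α))
      ⇔ (Logic._,_∼[_]_,_ k σ m 𝒬 𝔅 β q 𝔄 α)
proposition4p4 em k _ σ m 𝒬 q = χ-characterises k σ m 𝒬 (em (lsuc 0ℓ)) q
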